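{- Let $G$ be a finite simple connected graph of order $n$ which contains a cycle, and let $g$ be its girth (the length of a shortest cycle). Then for every integer $k\ge 0$, $\mu_k(G)\le n-g+2k+3$.
   Context: For $X\subseteq V(G)$ and an integer $k\ge 0$, two vertices $u,v\in V(G)$ are called $(X,k)$-visible if there exists a shortest $(u,v)$-path in $G$ having at most $k$ internal vertices that lie in $X$. A set $X\subseteq V(G)$ is a mutual $k$-visible set if every pair of distinct vertices of $X$ is $(X,k)$-visible. The mutual $k$-visibility number $\mu_k(G)$ is the maximum cardinality of a mutual $k$-visible set in $G$. -}

module Defs where

open import Data.Nat using (ℕ; zero; suc; _+_; _≤_)
open import Data.Bool using (Bool; true; false; if_then_else_)
open import Data.Fin using (Fin)
open import Data.Fin.Subset using (Subset; _∈_; ∣_∣)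
open import Data.Vec using (lookup)
open import Data.List using (List; []; _∷_)
open import Data.List.Relation.Unary.Unique.Propositional using (Unique)
open import Data.Product using (Σ; ∃; _×_; _,_)
open import Relation.Binary.PropositionalEquality using (_≡_; _≢_)

record Graph (n : ℕ) : Set where
  field
    adj    : Fin n → Fin n → Bool
    sym    : ∀ u v → adj u v ≡ adj v u
    irrefl : ∀ u → adj u u ≡ false
open Graph public

module _ {n : ℕ} (G : Graph n) where

  data Walk : Fin n → Fin n → Set where
    []   : ∀ {u} → Walk u u
    step : ∀ {u v} (w : Fin n) → adj G u w ≡ true → Walk w v → Walk u v

  len : ∀ {u v} → Walk u v → ℕ
  len []             = 0
  len (step _ _ p)   = suc (len p)

  verts : ∀ {u v} → Walk u v → List (Fin n)
  verts {u} []           = u ∷ []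
  verts {u} (step _ _ p) = u ∷ verts p

  inner : ∀ {u v} → Walk u v → List (Fin n)
  inner []                          = []
  inner (step w _ [])               = []
  inner (step w _ p@(step _ _ _))   = w ∷ inner p

  IsPath : ∀ {u v} → Walk u v → Set
  IsPath p = Unique (verts p)

  IsShortestPath : ∀ {u v} → Walk u v → Set
  IsShortestPath {u} {v} p = IsPath p × (∀ (q : Walk u v) → IsPath q → len p ≤ len q)

  Connected : Set
  Connected = ∀ u v → Walk u v

  -- a cycle: closed walk of length ≥ 3 whose vertices (with the
  -- closing vertex counted once) are pairwise distinct
  IsCycle : ∀ {v} → Walk v v → Set
  IsCycle {v} p = 3 ≤ len p × Unique (v ∷ inner p)

  HasCycle : Set
  HasCycle = Σ (Fin n) λ v → Σ (Walk v v) IsCycle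

  IsGirth : ℕ → Set
  IsGirth g = (Σ (Fin n) λ v → Σ (Walk v v) λ c → IsCycle c × len c ≡ g)
            × (∀ v (c : Walk v v) → IsCycle c → g ≤ len c)

  countIn : Subset n → List (Fin n) → ℕ
  countIn X []       = 0
  countIn X (w ∷ ws) = if lookup X w then suc (countIn X ws) else countIn X ws

  Visible : Subset n → ℕ → Fin n → Fin n → Set
  Visible X k u v = Σ (Walk u v) λ p → IsShortestPath p × countIn X (inner p) ≤ k

  MutualVisible : ℕ → Subset n → Set
  MutualVisible k X = ∀ u v → u ∈ X → v ∈ X → u ≢ v → Visible X k u v

  IsMu : ℕ → ℕ → Set
  IsMu k m = (Σ (Subset n) λ X → MutualVisible k X × ∣ X ∣ ≡ m)
           × (∀ X → MutualVisible k X → ∣ X ∣ ≤ m)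

-- Fix a shortest cycle C, of length g, and a mutual k-visible set X.  Two distinct
-- paths with the same ends have total length at least g: from the vertex where they
-- first diverge to the next vertex they share, they enclose a cycle.  So an arc of C
-- shorter than g/2 is the only path of at most its length between its ends; if both
-- ends lie in X, the arc must be the shortest path granted by visibility and has at
-- most k inner vertices in X.  Hence every window of C spanning less than half of it
-- contains at most k + 2 vertices of X, and covering C (rotated to start in X) by two
-- such windows gives |X ∩ C| ≤ 2k + 3.  The only exception is g = 2M with X
-- containing two antipodal vertices whose two half-cycles both carry more than k
-- inner vertices of X: a shortest path between them then runs outside C, and one of
-- its inner vertices lies neither in X nor on C.  Either way at least g − 2k − 3
-- vertices avoid X, so |X| ≤ n − g + 2k + 3.

module Submission where

open import Defs hiding (sym)
open import Data.Nat
  using (ℕ; zero; suc; _+_; _*_; _∸_; _≤_; _<_; z≤n; s≤s; s≤s⁻¹; s<s⁻¹; _%_; NonZero; >-nonZero)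
open import Data.Nat.DivMod
  using (m%n<n; m<n⇒m%n≡m; [m+n]%n≡m%n; %-distribˡ-+; n%n≡0; m≤n⇒[n∸m]%m≡n%m)
open import Data.Nat.Properties hiding (_≟_)
open import Data.Nat.Tactic.RingSolver using (solve-∀)
open import Data.Bool using (true; false)
open import Data.Fin using (Fin)
import Data.Vec as Vec
open import Data.Vec.Properties using (lookup⇒[]=; []=⇒lookup)
open import Data.Fin.Subset using (Subset; ∣_∣; ∁; _-_) renaming (_∈_ to _∈ₛ_; _∉_ to _∉ₛ_)
open import Data.Fin.Subset.Properties
  using (x∈p∧x≢y⇒x∈p-y; x∈p⇒∣p-x∣<∣p∣; x∉p⇒x∈∁p; ∣∁p∣≡n∸∣p∣; ∣p∣≤n)
  renaming (_∈?_ to _∈ₛ?_)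
open import Data.Fin.Properties using (_≟_)
open import Data.List using (List; []; _∷_; _++_; _∷ʳ_; [_]; length; reverse; applyUpTo; filter)
open import Data.List.Properties
  using ( ∷-injectiveʳ; ∷ʳ-injectiveˡ; ++-assoc; unfold-reverse; reverse-++
        ; applyUpTo-∷ʳ; length-applyUpTo; ≡-dec)
open import Data.List.Membership.Propositional using (_∈_; _∉_; lose)
open import Data.List.Membership.Propositional.Properties using (∈-++⁺ˡ; ∈-applyUpTo⁻; ∈-filter⁻)
open import Data.List.Relation.Unary.Any using (Any; here; there; any?)
import Data.List.Relation.Unary.Any.Properties as Any
open import Data.List.Relation.Unary.All using (All; []; _∷_)
import Data.List.Relation.Unary.All as All
import Data.List.Relation.Unary.All.Properties as All
open import Data.List.Relation.Unary.AllPairs using ([]; _∷_)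
open import Data.List.Relation.Unary.Unique.Propositional using (Unique)
open import Data.List.Relation.Unary.Unique.Propositional.Properties
  using (++⁺; applyUpTo⁺₁; filter⁺; Unique[x∷xs]⇒x∉xs)
open import Data.List.Relation.Binary.Disjoint.Propositional using (Disjoint)
open import Data.List.Relation.Binary.Permutation.Propositional using (↭-sym; ↭⇒↭ₛ)
open import Data.List.Relation.Binary.Permutation.Propositional.Properties using (↭-reverse)
import Data.List.Relation.Binary.Permutation.Setoid.Properties as Permutation
open import Data.Product using (Σ; ∃-syntax; _×_; _,_; proj₁; proj₂)
open import Data.Sum using (_⊎_; inj₁; inj₂)
open import Function using (_∘_; case_of_)
open import Relation.Nullary using (¬_; ¬?; Dec; yes; no; contradiction)
open import Relation.Binary using (tri<; tri≈; tri>)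
open import Relation.Unary using (Decidable)
open import Relation.Binary.PropositionalEquality
  using (_≡_; _≢_; refl; sym; trans; cong; cong₂; subst; subst₂; setoid; module ≡-Reasoning)

module _ {A : Set} where

  Unique-++⁻ˡ : ∀ xs {ys : List A} → Unique (xs ++ ys) → Unique xs
  Unique-++⁻ˡ []       _              = []
  Unique-++⁻ˡ (x ∷ xs) (x∉ ∷ unique) = All.++⁻ˡ xs x∉ ∷ Unique-++⁻ˡ xs unique

  Unique-++⁻ʳ : ∀ xs {ys : List A} → Unique (xs ++ ys) → Unique ys
  Unique-++⁻ʳ []       unique       = unique
  Unique-++⁻ʳ (x ∷ xs) (_ ∷ unique) = Unique-++⁻ʳ xs unique

  Unique-++⇒Disjoint : ∀ xs {ys : List A} → Unique (xs ++ ys) → Disjoint xs ys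
  Unique-++⇒Disjoint (x ∷ xs) (x∉ ∷ _)      (here refl , v∈ys)  = All.lookup (All.++⁻ʳ xs x∉) v∈ys refl
  Unique-++⇒Disjoint (x ∷ xs) (_ ∷ unique) (there v∈xs , v∈ys) =
    Unique-++⇒Disjoint xs unique (v∈xs , v∈ys)

  Unique-reverse : ∀ {xs : List A} → Unique xs → Unique (reverse xs)
  Unique-reverse {xs} = Permutation.Unique-resp-↭ (setoid A) (↭⇒↭ₛ (↭-sym (↭-reverse xs)))

applyUpTo-++ : ∀ {A : Set} (f : ℕ → A) a b →
  applyUpTo f (a + b) ≡ applyUpTo f a ++ applyUpTo (λ i → f (a + i)) b
applyUpTo-++ f zero    b = refl
applyUpTo-++ f (suc a) b = cong (f 0 ∷_) (applyUpTo-++ (f ∘ suc) a b)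

1+[1+k]+[1+k]≡2k+3 : ∀ k → suc (suc k + suc k) ≡ 2 * k + 3
1+[1+k]+[1+k]≡2k+3 = solve-∀

even-or-odd : ∀ m → ∃[ h ] (m ≡ h + h ⊎ m ≡ suc (h + h))
even-or-odd zero    = 0 , inj₁ refl
even-or-odd (suc m) with even-or-odd m
... | h , inj₁ m≡h+h   = h , inj₂ (cong suc m≡h+h)
... | h , inj₂ m≡1+h+h = suc h , inj₁ (cong suc (trans m≡1+h+h (sym (+-suc h h))))

m≢[m+d]%n : ∀ {m d n} .{{_ : NonZero n}} → m < n → 0 < d → d < n → m ≢ (m + d) % n
m≢[m+d]%n {m} {d} {n} m<n 0<d d<n m≡ with m + d <? n
... | yes m+d<n = <⇒≢ (m<m+n m 0<d) (trans m≡ (m<n⇒m%n≡m m+d<n))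
... | no  m+d≮n = <⇒≢ wrapped<m (sym (trans m≡ wrap))
  where
  n≤m+d : n ≤ m + d
  n≤m+d = ≮⇒≥ m+d≮n
  wrap : (m + d) % n ≡ m + d ∸ n
  wrap = trans (sym (m≤n⇒[n∸m]%m≡n%m n≤m+d)) (m<n⇒m%n≡m (m<n+o⇒m∸n<o (m + d) n (+-mono-< m<n d<n)))
  wrapped<m : m + d ∸ n < m
  wrapped<m = subst (m + d ∸ n <_) (m+n∸n≡m m n) (∸-monoˡ-< (+-monoʳ-< m d<n) n≤m+d)

%-≢-within-period : ∀ {i j n} .{{_ : NonZero n}} → i < j → j < i + n → i % n ≢ j % n
%-≢-within-period {i} {j} {n} i<j j<i+n i%n≡j%n =
  m≢[m+d]%n (m%n<n i n) (m<n⇒0<n∸m i<j) j∸i<n (begin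
    i % n                     ≡⟨ i%n≡j%n ⟩
    j % n                     ≡⟨ cong (_% n) (m+[n∸m]≡n (<⇒≤ i<j)) ⟨
    (i + (j ∸ i)) % n         ≡⟨ %-distribˡ-+ i (j ∸ i) n ⟩
    (i % n + (j ∸ i) % n) % n ≡⟨ cong (λ x → (i % n + x) % n) (m<n⇒m%n≡m j∸i<n) ⟩
    (i % n + (j ∸ i)) % n     ∎)
  where
  open ≡-Reasoning
  j∸i<n : j ∸ i < n
  j∸i<n = m<n+o⇒m∸n<o j i j<i+n

m+n≤o+p⇒m≤o∸n+p : ∀ m n o p → m + n ≤ o + p → m ≤ o ∸ n + p
m+n≤o+p⇒m≤o∸n+p m n o p m+n≤o+p =
  ≤-trans (m+n≤o⇒m≤o∸n m m+n≤o+p) (m≤n+o⇒m∸n≤o (o + p) n (begin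
    o + p             ≤⟨ +-monoˡ-≤ p (m≤n+m∸n o n) ⟩
    n + (o ∸ n) + p   ≡⟨ +-assoc n (o ∸ n) p ⟩
    n + (o ∸ n + p)   ∎))
  where open ≤-Reasoning

module _ {n : ℕ} where

  length≤∣p∣ : ∀ (p : Subset n) {L} → Unique L → All (_∈ₛ p) L → length L ≤ ∣ p ∣
  length≤∣p∣ p {[]}    _                _              = z≤n
  length≤∣p∣ p {x ∷ L} (x∉L ∷ L-unique) (x∈p ∷ L⊆p) =
    ≤-trans (s≤s (length≤∣p∣ (p - x) L-unique L⊆p-x)) (x∈p⇒∣p-x∣<∣p∣ x∈p)
    where
    L⊆p-x : All (_∈ₛ p - x) L
    L⊆p-x = All.zipWith (λ (z∈p , x≢z) → x∈p∧x≢y⇒x∈p-y z∈p (x≢z ∘ sym)) (L⊆p , x∉L)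

  ∣p∣+length≤n : ∀ (p : Subset n) {L} → Unique L → All (_∉ₛ p) L → ∣ p ∣ + length L ≤ n
  ∣p∣+length≤n p {L} L-unique L∉p = begin
    ∣ p ∣ + length L    ≤⟨ +-monoʳ-≤ ∣ p ∣ (length≤∣p∣ (∁ p) L-unique (All.map x∉p⇒x∈∁p L∉p)) ⟩
    ∣ p ∣ + ∣ ∁ p ∣     ≡⟨ cong (∣ p ∣ +_) (∣∁p∣≡n∸∣p∣ p) ⟩
    ∣ p ∣ + (n ∸ ∣ p ∣) ≡⟨ m+[n∸m]≡n (∣p∣≤n p) ⟩
    n                   ∎
    where open ≤-Reasoning

module Walks {n : ℕ} (G : Graph n) where

  private
    variable
      u v w x y : Fin n

  adj-sym : adj G u w ≡ true → adj G w u ≡ true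
  adj-sym {u} {w} e = trans (Graph.sym G w u) e

  initVerts : Walk G u v → List (Fin n)
  initVerts []               = []
  initVerts {u} (step _ _ p) = u ∷ initVerts p

  verts≡initVerts∷ʳ : (p : Walk G u v) → verts G p ≡ initVerts p ∷ʳ v
  verts≡initVerts∷ʳ []               = refl
  verts≡initVerts∷ʳ {u} (step _ _ p) = cong (u ∷_) (verts≡initVerts∷ʳ p)

  inner-step : ∀ (e : adj G u w ≡ true) (p : Walk G w v) → inner G (step w e p) ≡ initVerts p
  inner-step e []           = refl
  inner-step e (step _ e′ p) = cong (_ ∷_) (inner-step e′ p)

  initVerts-inner : (p : Walk G u v) → 1 ≤ len G p → initVerts p ≡ u ∷ inner G p
  initVerts-inner (step _ e p) _ = cong (_ ∷_) (sym (inner-step e p))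

  source∈verts : (p : Walk G u v) → u ∈ verts G p
  source∈verts []           = here refl
  source∈verts (step _ _ _) = here refl

  target∈verts : (p : Walk G u v) → v ∈ verts G p
  target∈verts []           = here refl
  target∈verts (step _ _ p) = there (target∈verts p)

  initVerts⊆verts : (p : Walk G u v) → x ∈ initVerts p → x ∈ verts G p
  initVerts⊆verts p x∈ = subst (_ ∈_) (sym (verts≡initVerts∷ʳ p)) (∈-++⁺ˡ x∈)

  verts-inner : (p : Walk G u v) → u ≢ v → verts G p ≡ u ∷ inner G p ∷ʳ v
  verts-inner []           u≢u = contradiction refl u≢u
  verts-inner (step _ e p) _   =
    cong (_ ∷_) (trans (verts≡initVerts∷ʳ p) (cong (_∷ʳ _) (sym (inner-step e p))))

  inner-from-verts : ∀ (p : Walk G u v) {xs} → u ≢ v → verts G p ≡ x ∷ xs ∷ʳ y → inner G p ≡ xs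
  inner-from-verts p {xs} u≢v eq =
    ∷ʳ-injectiveˡ (inner G p) xs (∷-injectiveʳ (trans (sym (verts-inner p u≢v)) eq))

  walk-len-pos : (p : Walk G u v) → u ≢ v → 1 ≤ len G p
  walk-len-pos []           u≢u = contradiction refl u≢u
  walk-len-pos (step _ _ _) _   = s≤s z≤n

  inner-∉-ends : (p : Walk G u v) → IsPath G p → x ∈ inner G p → x ≢ u × x ≢ v
  inner-∉-ends (step _ e p) p-path x∈ =
      (λ { refl → Unique[x∷xs]⇒x∉xs p-path (initVerts⊆verts p x∈p) })
    , (λ { refl → Unique-++⇒Disjoint (initVerts p)
                    (subst Unique (verts≡initVerts∷ʳ p) (Unique-++⁻ʳ [ _ ] p-path)) (x∈p , here refl) })
    where
    x∈p = subst (_ ∈_) (inner-step e p) x∈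

  inner⊆verts : (p : Walk G u v) → x ∈ inner G p → x ∈ verts G p
  inner⊆verts (step _ e p) x∈ = there (initVerts⊆verts p (subst (_ ∈_) (inner-step e p) x∈))

  length-initVerts : (p : Walk G u v) → length (initVerts p) ≡ len G p
  length-initVerts []           = refl
  length-initVerts (step _ _ p) = cong suc (length-initVerts p)

  length-inner : (p : Walk G u v) → length (inner G p) ≡ len G p ∸ 1
  length-inner []           = refl
  length-inner (step _ e p) = trans (cong length (inner-step e p)) (length-initVerts p)

  closed-path-len≡0 : (p : Walk G u u) → IsPath G p → len G p ≡ 0
  closed-path-len≡0 []           _           = refl
  closed-path-len≡0 (step _ _ p) p-path = contradiction (target∈verts p) (Unique[x∷xs]⇒x∉xs p-path)

  infixr 5 _++ʷ_
  _++ʷ_ : Walk G u x → Walk G x v → Walk G u v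
  []           ++ʷ q = q
  step w e p ++ʷ q = step w e (p ++ʷ q)

  len-++ʷ : (p : Walk G u x) (q : Walk G x v) → len G (p ++ʷ q) ≡ len G p + len G q
  len-++ʷ []           q = refl
  len-++ʷ (step _ _ p) q = cong suc (len-++ʷ p q)

  len≤len-++ʷ : (p : Walk G u x) (q : Walk G x v) → len G p ≤ len G (p ++ʷ q)
  len≤len-++ʷ p q = subst (len G p ≤_) (sym (len-++ʷ p q)) (m≤m+n (len G p) (len G q))

  initVerts-++ʷ : (p : Walk G u x) (q : Walk G x v) → initVerts (p ++ʷ q) ≡ initVerts p ++ initVerts q
  initVerts-++ʷ []               q = refl
  initVerts-++ʷ {u} (step _ _ p) q = cong (u ∷_) (initVerts-++ʷ p q)

  verts-++ʷ : (p : Walk G u x) (q : Walk G x v) → verts G (p ++ʷ q) ≡ initVerts p ++ verts G q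
  verts-++ʷ []               q = refl
  verts-++ʷ {u} (step _ _ p) q = cong (u ∷_) (verts-++ʷ p q)

  ∈-verts-++ʷ⁺ˡ : (p : Walk G u x) (q : Walk G x v) → y ∈ verts G p → y ∈ verts G (p ++ʷ q)
  ∈-verts-++ʷ⁺ˡ []           q (here refl) = source∈verts q
  ∈-verts-++ʷ⁺ˡ (step _ _ p) q (here refl) = here refl
  ∈-verts-++ʷ⁺ˡ (step _ _ p) q (there y∈)  = there (∈-verts-++ʷ⁺ˡ p q y∈)

  IsPath-++ʷ⁻ˡ : (p : Walk G u x) (q : Walk G x v) → IsPath G (p ++ʷ q) → IsPath G p
  IsPath-++ʷ⁻ˡ p q pq-path = subst Unique (sym (verts≡initVerts∷ʳ p))
    (++⁺ (Unique-++⁻ˡ (initVerts p) unique) ([] ∷ [])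
         λ { (y∈p , here refl) → Unique-++⇒Disjoint (initVerts p) unique (y∈p , source∈verts q) })
    where
    unique : Unique (initVerts p ++ verts G q)
    unique = subst Unique (verts-++ʷ p q) pq-path

  IsPath-++ʷ⁻ʳ : (p : Walk G u x) (q : Walk G x v) → IsPath G (p ++ʷ q) → IsPath G q
  IsPath-++ʷ⁻ʳ p q pq-path = Unique-++⁻ʳ (initVerts p) (subst Unique (verts-++ʷ p q) pq-path)

  split-first : ∀ {P : Fin n → Set} → Decidable P → (p : Walk G u v) → Any P (verts G p) →
    ∃[ x ] Σ (Walk G u x) λ p₁ → Σ (Walk G x v) λ p₂ →
      p ≡ p₁ ++ʷ p₂ × P x × All (¬_ ∘ P) (initVerts p₁)
  split-first {u} P? p Pp with P? u
  ... | yes Pu = u , [] , p , refl , Pu , []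
  split-first P? []           (here Pu) | no ¬Pu = contradiction Pu ¬Pu
  split-first P? (step w e p) (here Pu) | no ¬Pu = contradiction Pu ¬Pu
  split-first P? (step w e p) (there Pp) | no ¬Pu with split-first P? p Pp
  ... | x , p₁ , p₂ , refl , Px , ¬Pp₁ = x , step w e p₁ , p₂ , refl , Px , ¬Pu ∷ ¬Pp₁

  split : (p : Walk G u v) → x ∈ verts G p →
    Σ (Walk G u x) λ p₁ → Σ (Walk G x v) λ p₂ → p ≡ p₁ ++ʷ p₂
  split {x = x} p x∈p with split-first (x ≟_) p x∈p
  ... | _ , p₁ , p₂ , eq , refl , _ = p₁ , p₂ , eq

  initVerts-unique : (p : Walk G u v) → IsPath G p → Unique (initVerts p)
  initVerts-unique p p-path = Unique-++⁻ˡ (initVerts p) (subst Unique (verts≡initVerts∷ʳ p) p-path)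

  rev : Walk G u v → Walk G v u
  rev []               = []
  rev {u} (step w e p) = rev p ++ʷ step u (adj-sym e) []

  len-rev : (p : Walk G u v) → len G (rev p) ≡ len G p
  len-rev []           = refl
  len-rev (step w e p) = trans (len-++ʷ (rev p) _) (trans (cong (_+ 1) (len-rev p)) (+-comm (len G p) 1))

  verts-rev : (p : Walk G u v) → verts G (rev p) ≡ reverse (verts G p)
  verts-rev []               = refl
  verts-rev {u} (step w e p) = begin
    verts G (rev p ++ʷ step u _ [])  ≡⟨ verts-++ʷ (rev p) _ ⟩
    initVerts (rev p) ++ w ∷ u ∷ []  ≡⟨ ++-assoc (initVerts (rev p)) [ w ] [ u ] ⟨
    initVerts (rev p) ∷ʳ w ∷ʳ u      ≡⟨ cong (_∷ʳ u) (verts≡initVerts∷ʳ (rev p)) ⟨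
    verts G (rev p) ∷ʳ u             ≡⟨ cong (_∷ʳ u) (verts-rev p) ⟩
    reverse (verts G p) ∷ʳ u         ≡⟨ unfold-reverse u (verts G p) ⟨
    reverse (u ∷ verts G p)          ∎
    where open ≡-Reasoning

  IsPath-rev : (p : Walk G u v) → IsPath G p → IsPath G (rev p)
  IsPath-rev p p-path = subst Unique (sym (verts-rev p)) (Unique-reverse p-path)

  inner-rev : (p : Walk G u v) → u ≢ v → inner G (rev p) ≡ reverse (inner G p)
  inner-rev {u} {v} p u≢v = inner-from-verts (rev p) (u≢v ∘ sym) (begin
    verts G (rev p)                 ≡⟨ verts-rev p ⟩
    reverse (verts G p)             ≡⟨ cong reverse (verts-inner p u≢v) ⟩
    reverse (u ∷ inner G p ∷ʳ v)    ≡⟨ unfold-reverse u (inner G p ∷ʳ v) ⟩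
    reverse (inner G p ∷ʳ v) ∷ʳ u   ≡⟨ cong (_∷ʳ u) (reverse-++ (inner G p) [ v ]) ⟩
    v ∷ reverse (inner G p) ∷ʳ u    ∎)
    where open ≡-Reasoning

  cycle-from-paths : (p q : Walk G u v) → IsPath G p → IsPath G q →
    Disjoint (inner G p) (verts G q) → 3 ≤ len G p + len G q → IsCycle G (p ++ʷ rev q)
  cycle-from-paths [] q _ q-path _ 3≤ with () ← subst (3 ≤_) (closed-path-len≡0 q q-path) 3≤
  cycle-from-paths {u} p@(step w e p′) q p-path q-path inner-p∉q 3≤ = long , unique
    where
    long : 3 ≤ len G (p ++ʷ rev q)
    long = subst (3 ≤_) (sym (trans (len-++ʷ p (rev q)) (cong (len G p +_) (len-rev q)))) 3≤

    q⁻-path : IsPath G (rev q)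
    q⁻-path = IsPath-rev q q-path

    separate : Disjoint (initVerts p) (initVerts (rev q))
    separate (here refl , u∈q⁻) =
      Unique-++⇒Disjoint (initVerts (rev q)) (subst Unique (verts≡initVerts∷ʳ (rev q)) q⁻-path)
        (u∈q⁻ , here refl)
    separate (there z∈p′ , z∈q⁻) = inner-p∉q
      ( subst (_ ∈_) (sym (inner-step e p′)) z∈p′
      , Any.reverse⁻ (subst (_ ∈_) (verts-rev q) (initVerts⊆verts (rev q) z∈q⁻)))

    unique : Unique (u ∷ inner G (p ++ʷ rev q))
    unique = subst Unique (cong (u ∷_) (sym (trans (inner-step e (p′ ++ʷ rev q)) (initVerts-++ʷ p′ (rev q)))))
                   (++⁺ (initVerts-unique p p-path) (initVerts-unique (rev q) q⁻-path) separate)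

  fork-len : ∀ {a b} (e : adj G u a ≡ true) (e′ : adj G u b ≡ true) → a ≢ b →
    (p : Walk G a v) (q : Walk G b v) → 3 ≤ len G (step a e p) + len G (step b e′ q)
  fork-len e e′ a≢b [] []           = contradiction refl a≢b
  fork-len e e′ a≢b [] (step _ _ q) = s≤s (s≤s (s≤s z≤n))
  fork-len e e′ a≢b (step _ _ p) q  = s≤s (s≤s (≤-trans (s≤s z≤n) (m≤n+m (suc (len G q)) (len G p))))

  arc : ∀ {f : ℕ → Fin n} → (∀ i → adj G (f i) (f (suc i)) ≡ true) → ∀ d → Walk G (f 0) (f d)
  arc     f-adj zero    = []
  arc {f} f-adj (suc d) = step (f 1) (f-adj 0) (arc {f ∘ suc} (f-adj ∘ suc) d)

  len-arc : ∀ {f} (f-adj : ∀ i → adj G (f i) (f (suc i)) ≡ true) d → len G (arc f-adj d) ≡ d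
  len-arc f-adj zero    = refl
  len-arc {f} f-adj (suc d) = cong suc (len-arc {f ∘ suc} (f-adj ∘ suc) d)

  verts-arc : ∀ {f} (f-adj : ∀ i → adj G (f i) (f (suc i)) ≡ true) d →
    verts G (arc f-adj d) ≡ applyUpTo f (suc d)
  verts-arc     f-adj zero    = refl
  verts-arc {f} f-adj (suc d) = cong (f 0 ∷_) (verts-arc {f ∘ suc} (f-adj ∘ suc) d)

  vertexAt : Walk G u v → ℕ → Fin n
  vertexAt {u} []           _       = u
  vertexAt {u} (step _ _ p) zero    = u
  vertexAt     (step _ _ p) (suc i) = vertexAt p i

  vertexAt-0 : (p : Walk G u v) → vertexAt p 0 ≡ u
  vertexAt-0 []           = refl
  vertexAt-0 (step _ _ _) = refl

  vertexAt-len : (p : Walk G u v) → vertexAt p (len G p) ≡ v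
  vertexAt-len []           = refl
  vertexAt-len (step _ _ p) = vertexAt-len p

  vertexAt-adj : (p : Walk G u v) → ∀ {i} → i < len G p → adj G (vertexAt p i) (vertexAt p (suc i)) ≡ true
  vertexAt-adj {u} (step _ e p) {zero}  _         = subst (λ x → adj G u x ≡ true) (sym (vertexAt-0 p)) e
  vertexAt-adj     (step _ _ p) {suc i} (s≤s i<) = vertexAt-adj p i<

  vertexAt∈initVerts : (p : Walk G u v) → ∀ {i} → i < len G p → vertexAt p i ∈ initVerts p
  vertexAt∈initVerts (step _ _ p) {zero}  _         = here refl
  vertexAt∈initVerts (step _ _ p) {suc i} (s≤s i<) = there (vertexAt∈initVerts p i<)

  vertexAt-injective : (p : Walk G u v) → Unique (initVerts p) → ∀ {i j} → i < len G p → j < len G p →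
    vertexAt p i ≡ vertexAt p j → i ≡ j
  vertexAt-injective (step _ _ p) _              {zero}  {zero}  _        _        _  = refl
  vertexAt-injective (step _ _ p) (u∉p ∷ _)      {zero}  {suc j} _        (s≤s j<) eq =
    contradiction eq (All.lookup u∉p (vertexAt∈initVerts p j<))
  vertexAt-injective (step _ _ p) (u∉p ∷ _)      {suc i} {zero}  (s≤s i<) _        eq =
    contradiction (sym eq) (All.lookup u∉p (vertexAt∈initVerts p i<))
  vertexAt-injective (step _ _ p) (_ ∷ p-unique) {suc i} {suc j} (s≤s i<) (s≤s j<) eq =
    cong suc (vertexAt-injective p p-unique i< j< eq)

module Counting {n : ℕ} (G : Graph n) (X : Subset n) where

  private
    variable
      x : Fin n

  countIn-∈ : ∀ xs → x ∈ₛ X → countIn G X (x ∷ xs) ≡ suc (countIn G X xs)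
  countIn-∈ xs x∈X rewrite []=⇒lookup x∈X = refl

  countIn-∉ : ∀ xs → x ∉ₛ X → countIn G X (x ∷ xs) ≡ countIn G X xs
  countIn-∉ {x} xs x∉X with Vec.lookup X x in eq
  ... | true  = contradiction (lookup⇒[]= x X eq) x∉X
  ... | false = refl

  countIn-++ : ∀ xs ys → countIn G X (xs ++ ys) ≡ countIn G X xs + countIn G X ys
  countIn-++ []       ys = refl
  countIn-++ (x ∷ xs) ys with Vec.lookup X x
  ... | true  = cong suc (countIn-++ xs ys)
  ... | false = countIn-++ xs ys

  countIn-∷ʳ-∈ : ∀ xs → x ∈ₛ X → countIn G X (xs ∷ʳ x) ≡ suc (countIn G X xs)
  countIn-∷ʳ-∈ xs x∈X =
    trans (countIn-++ xs _) (trans (cong (countIn G X xs +_) (countIn-∈ [] x∈X)) (+-comm _ 1))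

  countIn-∷ʳ-∉ : ∀ xs → x ∉ₛ X → countIn G X (xs ∷ʳ x) ≡ countIn G X xs
  countIn-∷ʳ-∉ xs x∉X =
    trans (countIn-++ xs _) (trans (cong (countIn G X xs +_) (countIn-∉ [] x∉X)) (+-identityʳ _))

  countIn-reverse : ∀ xs → countIn G X (reverse xs) ≡ countIn G X xs
  countIn-reverse []       = refl
  countIn-reverse (x ∷ xs) = begin
    countIn G X (reverse (x ∷ xs))                ≡⟨ cong (countIn G X) (unfold-reverse x xs) ⟩
    countIn G X (reverse xs ∷ʳ x)                 ≡⟨ countIn-++ (reverse xs) [ x ] ⟩
    countIn G X (reverse xs) + countIn G X [ x ]  ≡⟨ cong (_+ countIn G X [ x ]) (countIn-reverse xs) ⟩
    countIn G X xs + countIn G X [ x ]            ≡⟨ +-comm (countIn G X xs) _ ⟩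
    countIn G X [ x ] + countIn G X xs            ≡⟨ countIn-++ [ x ] xs ⟨
    countIn G X (x ∷ xs)                          ∎
    where open ≡-Reasoning

  countIn≤length : ∀ xs → countIn G X xs ≤ length xs
  countIn≤length []       = z≤n
  countIn≤length (x ∷ xs) with Vec.lookup X x
  ... | true  = s≤s (countIn≤length xs)
  ... | false = m≤n⇒m≤1+n (countIn≤length xs)

  countIn<length⇒∉ : ∀ xs → countIn G X xs < length xs → ∃[ x ] x ∈ xs × x ∉ₛ X
  countIn<length⇒∉ (x ∷ xs) c<l with Vec.lookup X x in eq
  ... | true  = let (y , y∈xs , y∉X) = countIn<length⇒∉ xs (s<s⁻¹ c<l) in y , there y∈xs , y∉X
  ... | false = x , here refl , λ x∈X → case trans (sym ([]=⇒lookup x∈X)) eq of λ ()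

  length-filter-∉ : ∀ xs → length (filter (λ x → ¬? (x ∈ₛ? X)) xs) + countIn G X xs ≡ length xs
  length-filter-∉ []       = refl
  length-filter-∉ (x ∷ xs) with x ∈ₛ? X
  ... | yes x∈X = trans (cong (_ +_) (countIn-∈ xs x∈X)) (trans (+-suc _ _) (cong suc (length-filter-∉ xs)))
  ... | no  x∉X = trans (cong (suc _ +_) (countIn-∉ xs x∉X)) (cong suc (length-filter-∉ xs))

module CycleSeqs {n : ℕ} (G : Graph n) (g : ℕ) where

  open Walks G

  record IsCycleSeq (f : ℕ → Fin n) : Set where
    field
      adjacent  : ∀ i → adj G (f i) (f (suc i)) ≡ true
      injective : ∀ {i j} → i < j → j < i + g → f i ≢ f j
      periodic  : ∀ i → f (i + g) ≡ f i

  open IsCycleSeq public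

  shift : ∀ {f} → IsCycleSeq f → ∀ a → IsCycleSeq (λ i → f (a + i))
  shift {f} cf a = record
    { adjacent  = λ i → subst (λ j → adj G (f (a + i)) (f j) ≡ true) (sym (+-suc a i)) (adjacent cf (a + i))
    ; injective = λ {i} {j} i<j j<i+g → injective cf (+-monoʳ-< a i<j)
                                          (subst (a + j <_) (sym (+-assoc a i g)) (+-monoʳ-< a j<i+g))
    ; periodic  = λ i → trans (cong f (sym (+-assoc a i g))) (periodic cf (a + i))
    }

  arc-path : ∀ {f} (cf : IsCycleSeq f) d → d < g → IsPath G (arc (adjacent cf) d)
  arc-path {f} cf d d<g = subst Unique (sym (verts-arc (adjacent cf) d))
    (applyUpTo⁺₁ f (suc d) λ {i} i<j j≤d → injective cf i<j (≤-trans j≤d (≤-trans d<g (m≤n+m g i))))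

  cycle-unique : ∀ {f} → IsCycleSeq f → Unique (applyUpTo f g)
  cycle-unique {f} cf = applyUpTo⁺₁ f g λ {i} i<j j<g → injective cf i<j (≤-trans j<g (m≤n+m g i))

  module _ {v₀} (C : Walk G v₀ v₀) (C-cycle : IsCycle G C) (C-len : len G C ≡ g) where

    private
      3≤g : 3 ≤ g
      3≤g = subst (3 ≤_) C-len (proj₁ C-cycle)

      instance
        g-nonZero : NonZero g
        g-nonZero = >-nonZero (≤-trans (s≤s z≤n) 3≤g)

    unroll : ℕ → Fin n
    unroll i = vertexAt C (i % g)

    unroll-isCycleSeq : IsCycleSeq unroll
    unroll-isCycleSeq = record
      { adjacent  = adjacent′
      ; injective = λ {i} {j} i<j j<i+g eq → %-≢-within-period i<j j<i+g
          (vertexAt-injective C C-unique (%<len i) (%<len j) eq)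
      ; periodic  = λ i → cong (vertexAt C) ([m+n]%n≡m%n i g)
      }
      where
      C-unique : Unique (initVerts C)
      C-unique = subst Unique (sym (initVerts-inner C (≤-trans (s≤s z≤n) (proj₁ C-cycle)))) (proj₂ C-cycle)
      %<len : ∀ i → i % g < len G C
      %<len i = subst (i % g <_) (sym C-len) (m%n<n i g)
      suc-% : ∀ i → suc i % g ≡ suc (i % g) % g
      suc-% i = trans (%-distribˡ-+ 1 i g)
                      (cong (λ x → (x + i % g) % g) (m<n⇒m%n≡m (≤-trans (s≤s (s≤s z≤n)) 3≤g)))
      adjacent′ : ∀ i → adj G (unroll i) (unroll (suc i)) ≡ true
      adjacent′ i with m≤n⇒m<n∨m≡n (%<len i)
      ... | inj₁ 1+r<len = subst (λ x → adj G (unroll i) (vertexAt C x) ≡ true)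
              (sym (trans (suc-% i) (m<n⇒m%n≡m (subst (suc (i % g) <_) C-len 1+r<len))))
              (vertexAt-adj C (%<len i))
      ... | inj₂ 1+r≡len = subst (λ x → adj G (unroll i) x ≡ true) wraps (vertexAt-adj C (%<len i))
        where
        wraps : vertexAt C (suc (i % g)) ≡ unroll (suc i)
        wraps = begin
          vertexAt C (suc (i % g))      ≡⟨ cong (vertexAt C) 1+r≡len ⟩
          vertexAt C (len G C)          ≡⟨ vertexAt-len C ⟩
          v₀                            ≡⟨ vertexAt-0 C ⟨
          vertexAt C 0                  ≡⟨ cong (vertexAt C) (n%n≡0 g) ⟨
          vertexAt C (g % g)            ≡⟨ cong (λ x → vertexAt C (x % g)) (trans 1+r≡len C-len) ⟨
          vertexAt C (suc (i % g) % g)  ≡⟨ cong (vertexAt C) (suc-% i) ⟨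
          unroll (suc i)                ∎
          where open ≡-Reasoning

module Girth {n : ℕ} (G : Graph n) {g : ℕ}
             (girth-≤ : ∀ v (c : Walk G v v) → IsCycle G c → g ≤ len G c) where

  open import Data.List.Membership.DecPropositional (_≟_ {n}) using (_∈?_)
  open Walks G
  open CycleSeqs G g

  private
    variable
      u v : Fin n

  -- Cut p at its first vertex y on q: the two prefixes up to y close a cycle.
  girth-≤-fork : ∀ {a b} (e : adj G u a ≡ true) (e′ : adj G u b ≡ true) → a ≢ b →
    (p : Walk G a v) (q : Walk G b v) → IsPath G (step a e p) → IsPath G (step b e′ q) →
    g ≤ len G (step a e p) + len G (step b e′ q)
  girth-≤-fork {u} {a = a} {b = b} e e′ a≢b p q p-path q-path
    with split-first (λ z → z ∈? verts G q) p (lose (target∈verts p) (target∈verts q))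
  ... | y , p₁ , p₂ , refl , y∈q , p₁∉q with split q y∈q
  ... | q₁ , q₂ , refl = begin
    g                                         ≤⟨ girth-≤ u C C-cycle ⟩
    len G C                                   ≡⟨ trans (len-++ʷ P (rev Q)) (cong (len G P +_) (len-rev Q)) ⟩
    len G P + len G Q
      ≤⟨ +-mono-≤ (s≤s (len≤len-++ʷ p₁ p₂)) (s≤s (len≤len-++ʷ q₁ q₂)) ⟩
    len G (step a e p) + len G (step b e′ q)  ∎
    where
    open ≤-Reasoning
    P = step a e p₁
    Q = step b e′ q₁
    C = P ++ʷ rev Q
    P-path : IsPath G P
    P-path = IsPath-++ʷ⁻ˡ P p₂ p-path
    Q-path : IsPath G Q
    Q-path = IsPath-++ʷ⁻ˡ Q q₂ q-path
    P∉Q : Disjoint (inner G P) (verts G Q)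
    P∉Q (z∈P , z∈Q) with subst (_ ∈_) (inner-step e p₁) z∈P | z∈Q
    ... | z∈p₁ | here refl  =
      Unique[x∷xs]⇒x∉xs p-path (∈-verts-++ʷ⁺ˡ p₁ p₂ (initVerts⊆verts p₁ z∈p₁))
    ... | z∈p₁ | there z∈q₁ = All.lookup p₁∉q z∈p₁ (∈-verts-++ʷ⁺ˡ q₁ q₂ z∈q₁)
    C-cycle : IsCycle G C
    C-cycle = cycle-from-paths P Q P-path Q-path P∉Q (fork-len e e′ a≢b p₁ q₁)

  girth-≤-paths : (p q : Walk G u v) → IsPath G p → IsPath G q → verts G p ≢ verts G q →
    g ≤ len G p + len G q
  girth-≤-paths []             []             _      _      p≢q = contradiction refl p≢q
  girth-≤-paths []             q@(step _ _ _) _      q-path _   with () ← closed-path-len≡0 q q-path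
  girth-≤-paths p@(step _ _ _) []             p-path _      _   with () ← closed-path-len≡0 p p-path
  girth-≤-paths (step a e p) (step b e′ q) p-path q-path p≢q with a ≟ b
  ... | yes refl = ≤-trans (girth-≤-paths p q (tail p-path) (tail q-path) (p≢q ∘ cong (_ ∷_)))
                           (+-mono-≤ (n≤1+n (len G p)) (n≤1+n (len G q)))
    where tail = Unique-++⁻ʳ [ _ ]
  ... | no a≢b = girth-≤-fork e e′ a≢b p q p-path q-path

  arc-unique : ∀ {f} (cf : IsCycleSeq f) d {x y} (P : Walk G x y) → x ≡ f 0 → y ≡ f d →
    IsPath G P → len G P + d < g → verts G P ≡ applyUpTo f (suc d)
  arc-unique {f} cf d P refl refl P-path short with ≡-dec _≟_ (verts G P) (verts G (arc (adjacent cf) d))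
  ... | yes P≡A = trans P≡A (verts-arc (adjacent cf) d)
  ... | no  P≢A = contradiction (girth-≤-paths P A P-path A-path P≢A)
                    (<⇒≱ (subst (λ l → len G P + l < g) (sym (len-arc (adjacent cf) d)) short))
    where
    A = arc (adjacent cf) d
    A-path = arc-path cf d (≤-trans (s≤s (m≤n+m d (len G P))) short)

  -- Cut at f t, each part of P is short enough for arc-unique.
  arc-through : ∀ {f} (cf : IsCycleSeq f) {M t} → M + M ≤ g → 0 < t → t < M →
    ∀ {x y} (P : Walk G x y) → x ≡ f 0 → y ≡ f M → IsPath G P → len G P ≤ M → f t ∈ verts G P →
    verts G P ≡ applyUpTo f (suc M)
  arc-through {f} cf {M} {t} MM≤g 0<t t<M P refl refl P-path P≤M ft∈P with split P ft∈P
  ... | P₁ , P₂ , refl = begin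
    verts G (P₁ ++ʷ P₂)                                          ≡⟨ verts-++ʷ P₁ P₂ ⟩
    initVerts P₁ ++ verts G P₂                                   ≡⟨ cong₂ _++_ init₁ verts₂ ⟩
    applyUpTo f t ++ applyUpTo (λ i → f (t + i)) (suc (M ∸ t))  ≡⟨ applyUpTo-++ f t (suc (M ∸ t)) ⟨
    applyUpTo f (t + suc (M ∸ t))                                ≡⟨ cong (applyUpTo f) t+[1+M∸t]≡1+M ⟩
    applyUpTo f (suc M)                                          ∎
    where
    open ≡-Reasoning
    t+[1+M∸t]≡1+M : t + suc (M ∸ t) ≡ suc M
    t+[1+M∸t]≡1+M = trans (+-suc t (M ∸ t)) (cong suc (m+[n∸m]≡n (<⇒≤ t<M)))
    len₁+len₂≤M : len G P₁ + len G P₂ ≤ M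
    len₁+len₂≤M = subst (_≤ M) (len-++ʷ P₁ P₂) P≤M
    1≤len₁ : 1 ≤ len G P₁
    1≤len₁ = walk-len-pos P₁ (injective cf 0<t (≤-trans t<M (≤-trans (m≤m+n M M) MM≤g)))
    1≤len₂ : 1 ≤ len G P₂
    1≤len₂ = walk-len-pos P₂ (injective cf t<M (≤-<-trans (≤-trans (m≤m+n M M) MM≤g) (m<n+m g 0<t)))
    len₁<M : len G P₁ < M
    len₁<M = ≤-trans (≤-reflexive (+-comm 1 (len G P₁)))
                     (≤-trans (+-monoʳ-≤ (len G P₁) 1≤len₂) len₁+len₂≤M)
    len₂<M : len G P₂ < M
    len₂<M = ≤-trans (+-monoˡ-≤ (len G P₂) 1≤len₁) len₁+len₂≤M
    verts₁ : verts G P₁ ≡ applyUpTo f (suc t)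
    verts₁ = arc-unique cf t P₁ refl refl (IsPath-++ʷ⁻ˡ P₁ P₂ P-path)
               (≤-trans (+-mono-< len₁<M t<M) MM≤g)
    init₁ : initVerts P₁ ≡ applyUpTo f t
    init₁ = ∷ʳ-injectiveˡ (initVerts P₁) (applyUpTo f t)
              (trans (sym (verts≡initVerts∷ʳ P₁)) (trans verts₁ (sym (applyUpTo-∷ʳ f t))))
    verts₂ : verts G P₂ ≡ applyUpTo (λ i → f (t + i)) (suc (M ∸ t))
    verts₂ = arc-unique (shift cf t) (M ∸ t) P₂ (cong f (sym (+-identityʳ t)))
               (cong f (sym (m+[n∸m]≡n (<⇒≤ t<M)))) (IsPath-++ʷ⁻ʳ P₁ P₂ P-path)
               (≤-trans (+-mono-< len₂<M (∸-monoʳ-< 0<t (<⇒≤ t<M))) MM≤g)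

module Visibility {n : ℕ} (G : Graph n) {g : ℕ}
                  (girth-≤ : ∀ v (c : Walk G v v) → IsCycle G c → g ≤ len G c)
                  (X : Subset n) (k : ℕ) (X-visible : MutualVisible G k X) where

  open Walks G
  open Counting G X
  open CycleSeqs G g
  open Girth G girth-≤

  arc-inner-count : ∀ {f} (cf : IsCycleSeq f) d → suc d + suc d < g → f 0 ∈ₛ X → f (suc d) ∈ₛ X →
    countIn G X (applyUpTo (f ∘ suc) d) ≤ k
  arc-inner-count {f} cf d short f0∈X fd∈X = from-visible (X-visible _ _ f0∈X fd∈X f0≢fd)
    where
    1+d<g : suc d < g
    1+d<g = ≤-trans (s≤s (m≤m+n (suc d) (suc d))) short
    f0≢fd : f 0 ≢ f (suc d)
    f0≢fd = injective cf (s≤s z≤n) 1+d<g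
    from-visible : Visible G X k (f 0) (f (suc d)) → countIn G X (applyUpTo (f ∘ suc) d) ≤ k
    from-visible (P , (P-path , P-shortest) , P-count) = subst (λ xs → countIn G X xs ≤ k) P-inner P-count
      where
      P≤1+d : len G P ≤ suc d
      P≤1+d = subst (len G P ≤_) (len-arc (adjacent cf) (suc d))
                (P-shortest (arc (adjacent cf) (suc d)) (arc-path cf (suc d) 1+d<g))
      P-inner : inner G P ≡ applyUpTo (f ∘ suc) d
      P-inner = inner-from-verts P f0≢fd
        (trans (arc-unique cf (suc d) P refl refl P-path (≤-<-trans (+-monoˡ-≤ (suc d) P≤1+d) short))
               (cong (f 0 ∷_) (sym (applyUpTo-∷ʳ (f ∘ suc) d))))

  -- Shrink the window until both its ends lie in X, then apply arc-inner-count.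
  window-count : ∀ {f} → IsCycleSeq f → ∀ d → d + d < g → countIn G X (applyUpTo f (suc d)) ≤ 2 + k
  window-count {f} cf zero    _     = ≤-trans (countIn≤length [ f 0 ]) (s≤s z≤n)
  window-count {f} cf (suc d) short with f 0 ∈ₛ? X | f (suc d) ∈ₛ? X
  ... | no f0∉X | _ = begin
    countIn G X (applyUpTo f (2 + d))            ≡⟨ countIn-∉ (applyUpTo (f ∘ suc) (suc d)) f0∉X ⟩
    countIn G X (applyUpTo (f ∘ suc) (suc d))    ≤⟨ window-count (shift cf 1) d shorter ⟩
    2 + k                                        ∎
    where
    open ≤-Reasoning
    shorter = <-trans (s≤s (+-monoʳ-≤ d (n≤1+n d))) short
  ... | yes _ | no fd∉X = begin
    countIn G X (applyUpTo f (2 + d))                ≡⟨ cong (countIn G X) (applyUpTo-∷ʳ f (suc d)) ⟨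
    countIn G X (applyUpTo f (suc d) ∷ʳ f (suc d))   ≡⟨ countIn-∷ʳ-∉ (applyUpTo f (suc d)) fd∉X ⟩
    countIn G X (applyUpTo f (suc d))                ≤⟨ window-count cf d shorter ⟩
    2 + k                                            ∎
    where
    open ≤-Reasoning
    shorter = <-trans (s≤s (+-monoʳ-≤ d (n≤1+n d))) short
  ... | yes f0∈X | yes fd∈X = begin
    countIn G X (f 0 ∷ applyUpTo (f ∘ suc) (suc d))
      ≡⟨ countIn-∈ (applyUpTo (f ∘ suc) (suc d)) f0∈X ⟩
    suc (countIn G X (applyUpTo (f ∘ suc) (suc d)))
      ≡⟨ cong (suc ∘ countIn G X) (applyUpTo-∷ʳ (f ∘ suc) d) ⟨
    suc (countIn G X (applyUpTo (f ∘ suc) d ∷ʳ f (suc d)))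
      ≡⟨ cong suc (countIn-∷ʳ-∈ (applyUpTo (f ∘ suc) d) fd∈X) ⟩
    2 + countIn G X (applyUpTo (f ∘ suc) d)
      ≤⟨ s≤s (s≤s (arc-inner-count cf d short f0∈X fd∈X)) ⟩
    2 + k
      ∎
    where open ≤-Reasoning

  count-after-∈ : ∀ {f} → IsCycleSeq f → ∀ d → d + d < g → f 0 ∈ₛ X →
    countIn G X (applyUpTo (f ∘ suc) d) ≤ suc k
  count-after-∈ {f} cf d short f0∈X =
    s≤s⁻¹ (subst (_≤ 2 + k) (countIn-∈ (applyUpTo (f ∘ suc) d) f0∈X) (window-count cf d short))

  count-before-∈ : ∀ {f} → IsCycleSeq f → ∀ d → d + d < g → f d ∈ₛ X →
    countIn G X (applyUpTo f d) ≤ suc k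
  count-before-∈ {f} cf d short fd∈X = s≤s⁻¹ (subst (_≤ 2 + k)
    (trans (cong (countIn G X) (sym (applyUpTo-∷ʳ f d))) (countIn-∷ʳ-∈ (applyUpTo f d) fd∈X))
    (window-count cf d short))

  -- An inner vertex of P on the cycle would pin P, or its reverse, to a half-cycle.
  off-cycle : ∀ {f} (cf : IsCycleSeq f) M′ (let M = suc M′) → M + M ≡ g →
    (P : Walk G (f 0) (f M)) → IsPath G P → len G P ≤ M →
    verts G P ≢ applyUpTo f (suc M) → verts G (rev P) ≢ applyUpTo (λ i → f (M + i)) (suc M) →
    ∀ {w} → w ∈ inner G P → w ∉ applyUpTo f g
  off-cycle {f} cf M′ MM≡g P P-path P≤M P≢A₁ P⁻≢A₂ w∈P w∈C with ∈-applyUpTo⁻ f w∈C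
  ... | zero   , _   , refl = proj₁ (inner-∉-ends P P-path w∈P) refl
  ... | suc t′ , t<g , refl with <-cmp (suc t′) (suc M′)
  ...   | tri< t<M _ _ = P≢A₁ (arc-through cf (≤-reflexive MM≡g) (s≤s z≤n) t<M P refl refl P-path P≤M
                           (inner⊆verts P w∈P))
  ...   | tri≈ _ t≡M _ = proj₂ (inner-∉-ends P P-path w∈P) (cong f t≡M)
  ...   | tri> _ _ M<t = P⁻≢A₂ (arc-through (shift cf M) (≤-reflexive MM≡g) (m<n⇒0<n∸m M<t) t∸M<M
                           (rev P)
                           (cong f (sym (+-identityʳ M))) f0≡f[M+M] (IsPath-rev P P-path)
                           (subst (_≤ M) (sym (len-rev P)) P≤M) w∈P⁻)
    where
    M = suc M′
    t = suc t′
    t∸M<M : t ∸ M < M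
    t∸M<M = m<n+o⇒m∸n<o t M (subst (t <_) (sym MM≡g) t<g)
    f0≡f[M+M] : f 0 ≡ f (M + M)
    f0≡f[M+M] = sym (trans (cong f MM≡g) (periodic cf 0))
    w∈P⁻ : f (M + (t ∸ M)) ∈ verts G (rev P)
    w∈P⁻ = subst₂ _∈_ (cong f (sym (m+[n∸m]≡n (<⇒≤ M<t)))) (sym (verts-rev P))
             (Any.reverse⁺ (inner⊆verts P w∈P))

  -- A shortest path P from f 0 to f M has at most k inner vertices in X, so it is
  -- neither half-cycle; by the girth it has length M, hence M − 1 > k inner vertices.
  antipodal-vertex : ∀ {f} (cf : IsCycleSeq f) M′ (let M = suc M′) → M + M ≡ g →
    f 0 ∈ₛ X → f M ∈ₛ X →
    k < countIn G X (applyUpTo (f ∘ suc) M′) → k < countIn G X (applyUpTo (λ i → f (M + suc i)) M′) →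
    ∃[ w ] w ∉ₛ X × w ∉ applyUpTo f g
  antipodal-vertex {f} cf M′ MM≡g f0∈X fM∈X k<I₁ k<I₂ = from-visible (X-visible _ _ f0∈X fM∈X f0≢fM)
    where
    M = suc M′
    M<g : M < g
    M<g = subst (M <_) MM≡g (m<m+n M (s≤s z≤n))
    f0≢fM : f 0 ≢ f M
    f0≢fM = injective cf (s≤s z≤n) M<g
    A₁ = arc (adjacent cf) M
    from-visible : Visible G X k (f 0) (f M) → ∃[ w ] w ∉ₛ X × w ∉ applyUpTo f g
    from-visible (P , (P-path , P-shortest) , P-count) =
      let (w , w∈P , w∉X) = countIn<length⇒∉ (inner G P) sparse
      in  w , w∉X , off-cycle cf M′ MM≡g P P-path P≤M P≢A₁ P⁻≢A₂ w∈P
      where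
      P≤M : len G P ≤ M
      P≤M = subst (len G P ≤_) (len-arc (adjacent cf) M) (P-shortest A₁ (arc-path cf M M<g))
      P≢A₁ : verts G P ≢ applyUpTo f (suc M)
      P≢A₁ eq = <⇒≱ k<I₁ (subst (λ xs → countIn G X xs ≤ k)
        (inner-from-verts P f0≢fM (trans eq (cong (f 0 ∷_) (sym (applyUpTo-∷ʳ (f ∘ suc) M′))))) P-count)
      P⁻≢A₂ : verts G (rev P) ≢ applyUpTo (λ i → f (M + i)) (suc M)
      P⁻≢A₂ eq = <⇒≱ k<I₂ (begin
        countIn G X (applyUpTo (λ i → f (M + suc i)) M′)  ≡⟨ cong (countIn G X) P⁻-inner ⟨
        countIn G X (inner G (rev P))                    ≡⟨ cong (countIn G X) (inner-rev P f0≢fM) ⟩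
        countIn G X (reverse (inner G P))                ≡⟨ countIn-reverse (inner G P) ⟩
        countIn G X (inner G P)                          ≤⟨ P-count ⟩
        k                                                ∎)
        where
        open ≤-Reasoning
        P⁻-inner : inner G (rev P) ≡ applyUpTo (λ i → f (M + suc i)) M′
        P⁻-inner = inner-from-verts (rev P) (f0≢fM ∘ sym)
          (trans eq (cong (f (M + 0) ∷_) (sym (applyUpTo-∷ʳ (λ i → f (M + suc i)) M′))))
      M≤P : M ≤ len G P
      M≤P = +-cancelʳ-≤ M M (len G P) (begin
        M + M               ≡⟨ MM≡g ⟩
        g                   ≤⟨ girth-≤-paths P A₁ P-path (arc-path cf M M<g)
                                 (λ eq → P≢A₁ (trans eq (verts-arc (adjacent cf) M))) ⟩
        len G P + len G A₁  ≡⟨ cong (len G P +_) (len-arc (adjacent cf) M) ⟩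
        len G P + M         ∎)
        where open ≤-Reasoning
      sparse : countIn G X (inner G P) < length (inner G P)
      sparse = begin-strict
        countIn G X (inner G P)                     ≤⟨ P-count ⟩
        k                                           <⟨ k<I₁ ⟩
        countIn G X (applyUpTo (f ∘ suc) M′)        ≤⟨ countIn≤length (applyUpTo (f ∘ suc) M′) ⟩
        length (applyUpTo (f ∘ suc) M′)             ≡⟨ length-applyUpTo (f ∘ suc) M′ ⟩
        M′                                          ≤⟨ ∸-monoˡ-≤ 1 M≤P ⟩
        len G P ∸ 1                                 ≡⟨ length-inner P ⟨
        length (inner G P)                          ∎
        where open ≤-Reasoning

  odd-cycle-count : ∀ {f} → IsCycleSeq f → ∀ h → g ≡ suc (h + h) → f 0 ∈ₛ X →
    countIn G X (applyUpTo f g) ≤ 2 * k + 3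
  odd-cycle-count {f} cf h g≡1+h+h f0∈X = begin
    countIn G X (applyUpTo f g)
      ≡⟨ cong (countIn G X ∘ applyUpTo f) g≡1+h+h ⟩
    countIn G X (applyUpTo f (suc h + h))
      ≡⟨ cong (countIn G X) (applyUpTo-++ f (suc h) h) ⟩
    countIn G X (applyUpTo f (suc h) ++ applyUpTo f′ h)
      ≡⟨ countIn-++ (applyUpTo f (suc h)) _ ⟩
    countIn G X (applyUpTo f (suc h)) + countIn G X (applyUpTo f′ h)
      ≡⟨ cong (_+ countIn G X (applyUpTo f′ h)) (countIn-∈ (applyUpTo (f ∘ suc) h) f0∈X) ⟩
    suc (countIn G X (applyUpTo (f ∘ suc) h)) + countIn G X (applyUpTo f′ h)
      ≤⟨ +-mono-≤ (s≤s (count-after-∈ cf h h+h<g f0∈X)) (count-before-∈ (shift cf (suc h)) h h+h<g f′h∈X) ⟩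
    suc (suc k) + suc k
      ≡⟨ 1+[1+k]+[1+k]≡2k+3 k ⟩
    2 * k + 3
      ∎
    where
    open ≤-Reasoning
    f′ = λ i → f (suc h + i)
    h+h<g : h + h < g
    h+h<g = ≤-reflexive (sym g≡1+h+h)
    f′h∈X : f′ h ∈ₛ X
    f′h∈X = subst (_∈ₛ X) (sym (trans (cong f (sym g≡1+h+h)) (periodic cf 0))) f0∈X

  CycleCountBound : (ℕ → Fin n) → Set
  CycleCountBound f = countIn G X (applyUpTo f g) ≤ 2 * k + 3 ⊎
    countIn G X (applyUpTo f g) ≤ suc (2 * k + 3) × ∃[ w ] w ∉ₛ X × w ∉ applyUpTo f g

  even-cycle-count : ∀ {f} → IsCycleSeq f → ∀ M′ (let M = suc M′) → M + M ≡ g → f 0 ∈ₛ X →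
    CycleCountBound f
  even-cycle-count {f} cf M′ MM≡g f0∈X = by-middle (f′ 0 ∈ₛ? X)
    where
    open ≤-Reasoning
    M = suc M′
    f′ = λ i → f (M + i)
    f″ = λ i → f (M + suc i)
    I₁ = countIn G X (applyUpTo (f ∘ suc) M′)
    I₂ = countIn G X (applyUpTo f″ M′)
    c = countIn G X (applyUpTo f g)
    M′+M′<g : M′ + M′ < g
    M′+M′<g = ≤-trans (s≤s (+-monoʳ-≤ M′ (n≤1+n M′))) (≤-reflexive MM≡g)
    I₁≤1+k : I₁ ≤ suc k
    I₁≤1+k = count-after-∈ cf M′ M′+M′<g f0∈X
    I₂≤1+k : I₂ ≤ suc k
    I₂≤1+k = count-before-∈ (shift (shift cf M) 1) M′ M′+M′<g
               (subst (_∈ₛ X) (sym (trans (cong f MM≡g) (periodic cf 0))) f0∈X)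
    count : c ≡ suc (I₁ + countIn G X (f′ 0 ∷ applyUpTo f″ M′))
    count = begin-equality
      c
        ≡⟨ cong (countIn G X ∘ applyUpTo f) MM≡g ⟨
      countIn G X (applyUpTo f (M + M))
        ≡⟨ cong (countIn G X) (applyUpTo-++ f M M) ⟩
      countIn G X (applyUpTo f M ++ applyUpTo f′ M)
        ≡⟨ countIn-++ (applyUpTo f M) _ ⟩
      countIn G X (applyUpTo f M) + countIn G X (applyUpTo f′ M)
        ≡⟨ cong (_+ countIn G X (applyUpTo f′ M)) (countIn-∈ (applyUpTo (f ∘ suc) M′) f0∈X) ⟩
      suc (I₁ + countIn G X (f′ 0 ∷ applyUpTo f″ M′))
        ∎

    by-middle : Dec (f′ 0 ∈ₛ X) → CycleCountBound f
    by-middle (no fM∉X) = inj₁ (begin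
      c                             ≡⟨ trans count (cong (suc ∘ (I₁ +_)) (countIn-∉ (applyUpTo f″ M′) fM∉X)) ⟩
      suc (I₁ + I₂)                 ≤⟨ s≤s (+-mono-≤ I₁≤1+k I₂≤1+k) ⟩
      suc (suc k + suc k)           ≡⟨ 1+[1+k]+[1+k]≡2k+3 k ⟩
      2 * k + 3                     ∎)
    by-middle (yes fM∈X) = by-halves (k <? I₁) (k <? I₂)
      where
      count≤ : ∀ {a b} → I₁ ≤ a → I₂ ≤ b → c ≤ suc (a + suc b)
      count≤ {a} {b} I₁≤a I₂≤b = begin
        c                           ≡⟨ trans count (cong (suc ∘ (I₁ +_)) (countIn-∈ (applyUpTo f″ M′) fM∈X)) ⟩
        suc (I₁ + suc I₂)           ≤⟨ s≤s (+-mono-≤ I₁≤a (s≤s I₂≤b)) ⟩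
        suc (a + suc b)             ∎
      by-halves : Dec (k < I₁) → Dec (k < I₂) → CycleCountBound f
      by-halves (yes k<I₁) (yes k<I₂) = inj₂
        ( subst (c ≤_) (cong suc (trans (+-suc (suc k) (suc k)) (1+[1+k]+[1+k]≡2k+3 k)))
                (count≤ I₁≤1+k I₂≤1+k)
        , antipodal-vertex cf M′ MM≡g f0∈X (subst (_∈ₛ X) (cong f (+-identityʳ M)) fM∈X) k<I₁ k<I₂)
      by-halves (no k≮I₁) _ = inj₁ (subst (c ≤_) (trans (cong suc (+-suc k (suc k))) (1+[1+k]+[1+k]≡2k+3 k))
                                         (count≤ (≮⇒≥ k≮I₁) I₂≤1+k))
      by-halves _ (no k≮I₂) = inj₁ (subst (c ≤_) (1+[1+k]+[1+k]≡2k+3 k) (count≤ I₁≤1+k (≮⇒≥ k≮I₂)))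

  cycle-count : ∀ {f} → IsCycleSeq f → f 0 ∈ₛ X → CycleCountBound f
  cycle-count {f} cf f0∈X with even-or-odd g
  ... | h      , inj₂ g≡1+h+h = inj₁ (odd-cycle-count cf h g≡1+h+h f0∈X)
  ... | zero   , inj₁ g≡0     =
    inj₁ (subst (λ l → countIn G X (applyUpTo f l) ≤ 2 * k + 3) (sym g≡0) z≤n)
  ... | suc M′ , inj₁ g≡M+M   = even-cycle-count cf M′ (sym g≡M+M) f0∈X

  ManyOutside : Set
  ManyOutside = ∃[ L ] Unique L × All (_∉ₛ X) L × g ≤ length L + (2 * k + 3)

  outside-list-from-∈ : ∀ {f} → IsCycleSeq f → f 0 ∈ₛ X → ManyOutside
  outside-list-from-∈ {f} cf f0∈X = from-bound (cycle-count cf f0∈X)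
    where
    open ≤-Reasoning
    C = applyUpTo f g
    L = filter (λ x → ¬? (x ∈ₛ? X)) C
    L-unique : Unique L
    L-unique = filter⁺ (λ x → ¬? (x ∈ₛ? X)) (cycle-unique cf)
    L⊆C∖X : ∀ {x} → x ∈ L → x ∈ C × x ∉ₛ X
    L⊆C∖X = ∈-filter⁻ (λ x → ¬? (x ∈ₛ? X)) {xs = C}
    L∉X : All (_∉ₛ X) L
    L∉X = All.tabulate (proj₂ ∘ L⊆C∖X)
    g≡L+c : g ≡ length L + countIn G X C
    g≡L+c = sym (trans (length-filter-∉ C) (length-applyUpTo f g))
    from-bound : CycleCountBound f → ManyOutside
    from-bound (inj₁ c≤) = L , L-unique , L∉X , (begin
      g                          ≡⟨ g≡L+c ⟩
      length L + countIn G X C   ≤⟨ +-monoʳ-≤ (length L) c≤ ⟩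
      length L + (2 * k + 3)     ∎)
    from-bound (inj₂ (c≤ , w , w∉X , w∉C)) =
      w ∷ L , All.tabulate (λ { z∈L refl → w∉C (proj₁ (L⊆C∖X z∈L)) }) ∷ L-unique
            , w∉X ∷ L∉X , (begin
      g                              ≡⟨ g≡L+c ⟩
      length L + countIn G X C       ≤⟨ +-monoʳ-≤ (length L) c≤ ⟩
      length L + suc (2 * k + 3)     ≡⟨ +-suc (length L) (2 * k + 3) ⟩
      suc (length L) + (2 * k + 3)   ∎)

  outside-list : ∀ {f} → IsCycleSeq f → ManyOutside
  outside-list {f} cf with any? (_∈ₛ? X) (applyUpTo f g)
  ... | yes X∩C≢∅ = let (i , _ , fi∈X) = Any.applyUpTo⁻ f X∩C≢∅ in
    outside-list-from-∈ (shift cf i) (subst (_∈ₛ X) (cong f (sym (+-identityʳ i))) fi∈X)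
  ... | no  X∩C≡∅ =
    applyUpTo f g , cycle-unique cf , All.tabulate (λ x∈C x∈X → X∩C≡∅ (lose x∈C x∈X))
    , subst (_≤ length (applyUpTo f g) + (2 * k + 3)) (length-applyUpTo f g) (m≤m+n _ (2 * k + 3))

theorem3p9 : ∀ (n : ℕ) (G : Graph n) → Connected G → HasCycle G →
    ∀ (g : ℕ) → IsGirth G g →
    ∀ (k m : ℕ) → IsMu G k m → m ≤ (n ∸ g) + 2 * k + 3
theorem3p9 n G _ _ g ((_ , C , C-cycle , C-len) , girth-≤) k _ ((X , X-visible , refl) , _)
  with Visibility.outside-list G girth-≤ X k X-visible (CycleSeqs.unroll-isCycleSeq G g C C-cycle C-len)
... | L , L-unique , L∉X , g≤L+K =
  subst (∣ X ∣ ≤_) (sym (+-assoc (n ∸ g) (2 * k) 3)) (m+n≤o+p⇒m≤o∸n+p ∣ X ∣ g n (2 * k + 3) (begin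
    ∣ X ∣ + g                          ≤⟨ +-monoʳ-≤ ∣ X ∣ g≤L+K ⟩
    ∣ X ∣ + (length L + (2 * k + 3))   ≡⟨ +-assoc ∣ X ∣ (length L) (2 * k + 3) ⟨
    ∣ X ∣ + length L + (2 * k + 3)     ≤⟨ +-monoˡ-≤ (2 * k + 3) (∣p∣+length≤n X L-unique L∉X) ⟩
    n + (2 * k + 3)                    ∎))
  where open ≤-Reasoning
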